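{- Let $G$ be a graph on vertex set $\{1,\dots,n\}$, let $\phi$ be an automorphism of $G$ of order $p^N$ for a prime $p$ and integer $N>0$, and let $M$ be an $n\times n$ automorphism compatible matrix on $G$. Let $r$ be the number of orbits of $\phi$ of length $p^N$, and let $\mathcal{T}_0=(v_1,\dots,v_r)$ be an (ordered) transversal of these orbits, i.e. one vertex from each orbit of length $p^N$. For $m\ge 0$ let $\mathcal{T}_m=(\phi^m(v_1),\dots,\phi^m(v_r))$, and for $s=0,\dots,p-1$ let $\tilde{\mathcal{T}}_s=\mathcal{T}_{sp^{N-1}}\cup\mathcal{T}_{sp^{N-1}+1}\cup\cdots\cup\mathcal{T}_{sp^{N-1}+p^{N-1}-1}$ (ordered by concatenation). Let $\mathcal{T}_F=\{v\in V(G): |\mathcal{O}_\phi(v)|<p^N\}$, $f=|\mathcal{T}_F|$, and set \[ F=M[\mathcal{T}_F,\mathcal{T}_F],\ H=M[\mathcal{T}_F,\tilde{\mathcal{T}}_0],\ L=M[\tilde{\mathcal{T}}_0,\mathcal{T}_F],\ C_m=M[\mathcal{T}_0,\mathcal{T}_m]\ (0\le m\le p^N-1),\ D_s=M[\tilde{\mathcal{T}}_0,\tilde{\mathcal{T}}_s]\ (0\le s\le p-1). \] Then after permuting the rows and columns of $M$ (simultaneously) into the order $\mathcal{T}_F,\mathcal{T}_0,\mathcal{T}_1,\dots,\mathcal{T}_{p^N-1}$, the resulting matrix has the form \[ \begin{bmatrix} F & H & \cdots & H\\ L & & & \\ \vdots & & C & \\ L & & & \end{bmatrix} \] ($H$ repeated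 $p$ times, $L$ repeated $p$ times), where $C=M[\mathcal{T}_0\cup\cdots\cup\mathcal{T}_{p^N-1},\mathcal{T}_0\cup\cdots\cup\mathcal{T}_{p^N-1}]$ is block-circulant with respect to its $r\times r$ blocks (its $(a,b)$ block is $C_{(b-a)\bmod p^N}$) and also block-circulant with respect to its $rp^{N-1}\times rp^{N-1}$ blocks (its $(a,b)$ block is $D_{(b-a)\bmod p}$).
   Context: An automorphism of a (possibly directed, possibly weighted) graph $G$ is a bijection $\phi:V(G)\to V(G)$ preserving adjacency (and edge weights). An $n\times n$ matrix $M$ is automorphism compatible on $G$ if $M_{\phi(i),\phi(j)}=M_{i,j}$ for every automorphism $\phi$ of $G$ and all $i,j$. The orbit $\mathcal{O}_\phi(v)$ is $\{\phi^j(v):j\ge 0\}$. For ordered index sets $X,Y$, $M[X,Y]$ is the submatrix of $M$ with rows indexed by $X$ and columns by $Y$ (in the given order). -}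

module Defs where

open import Data.Nat using (ℕ; zero; suc; _+_; _*_; _∸_; _^_; _<_; _%_)
open import Data.Fin using (Fin; toℕ)
open import Data.Product using (_×_; _,_; Σ; ∃)
open import Data.Sum using (_⊎_; inj₁; inj₂)
open import Function using (id; _∘_)
open import Function.Definitions using (Bijective; Injective)
open import Relation.Binary.PropositionalEquality using (_≡_; _≢_)
open import Relation.Nullary using (¬_)

pow : ∀ {n} → (Fin n → Fin n) → ℕ → Fin n → Fin n
pow φ zero    = id
pow φ (suc k) = φ ∘ pow φ k

-- A (possibly directed, possibly weighted) graph on vertex set Fin n is given
-- by its weight/adjacency function G : Fin n → Fin n → W (e.g. W = Bool for
-- plain (di)graphs).
IsAutomorphism : ∀ {n} {W : Set} → (Fin n → Fin n → W) → (Fin n → Fin n) → Set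
IsAutomorphism G ψ = Bijective _≡_ _≡_ ψ × (∀ i j → G (ψ i) (ψ j) ≡ G i j)

AutCompatible : ∀ {n} {W R : Set} → (Fin n → Fin n → W) → (Fin n → Fin n → R) → Set
AutCompatible G M = ∀ ψ → IsAutomorphism G ψ → ∀ i j → M (ψ i) (ψ j) ≡ M i j

HasOrder : ∀ {n} → (Fin n → Fin n) → ℕ → Set
HasOrder φ k = 0 < k × (∀ x → pow φ k x ≡ x)
             × (∀ j → 0 < j → j < k → ¬ (∀ x → pow φ j x ≡ x))

-- |O_φ(v)| = k : the orbit {φ^j v : j ≥ 0} has exactly k elements, i.e. k is
-- the least positive j with φ^j v = v (the orbit being φ^0 v, …, φ^(k-1) v).
OrbitSize : ∀ {n} → (Fin n → Fin n) → Fin n → ℕ → Set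
OrbitSize φ v k = 0 < k × pow φ k v ≡ v × (∀ j → 0 < j → j < k → pow φ j v ≢ v)

IsTransversal : ∀ {n r} → (Fin n → Fin n) → ℕ → (Fin r → Fin n) → Set
IsTransversal {n} {r} φ k v =
    (∀ i → OrbitSize φ (v i) k)
  × (∀ i i' j → pow φ j (v i) ≡ v i' → i ≡ i')
  × (∀ w → OrbitSize φ w k → ∃ λ i → ∃ λ j → pow φ j (v i) ≡ w)

-- TF : Fin f → Fin n is an enumeration (in some order) of
-- T_F = { w : |O_φ(w)| < k }, so that f = |T_F|
Enumerates-T_F : ∀ {n f} → (Fin n → Fin n) → ℕ → (Fin f → Fin n) → Set
Enumerates-T_F φ k TF =
    Injective _≡_ _≡_ TF
  × (∀ w → (∃ λ a → TF a ≡ w) → ∃ λ l → OrbitSize φ w l × l < k)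
  × (∀ w → (∃ λ l → OrbitSize φ w l × l < k) → ∃ λ a → TF a ≡ w)

-- (b - a) mod k  (value 0 for k = 0, never used)
subMod : ℕ → ℕ → ℕ → ℕ
subMod zero      b a = 0
subMod (suc k)   b a = (b + suc k ∸ a) % suc k

-- Row/column order T_F, T_0, T_1, …, T_(p^N - 1):
-- inj₁ a            ↦ a-th element of T_F
-- inj₂ (s , t , i)  ↦ i-th element of T_m with m = s·q + t  (q = p^(N-1)),
-- i.e. φ^m (v_i).  Lexicographic order on (s,t,i) is the order of the paper.
Index : ℕ → ℕ → ℕ → ℕ → Set
Index f p q r = Fin f ⊎ (Fin p × Fin q × Fin r)

blockNo : ∀ {p q} → Fin p → Fin q → ℕ
blockNo {q = q} s t = toℕ s * q + toℕ t

order : ∀ {n f p q r} → (Fin n → Fin n) → (Fin f → Fin n) → (Fin r → Fin n)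
      → Index f p q r → Fin n
order φ TF v (inj₁ a)           = TF a
order φ TF v (inj₂ (s , t , i)) = pow φ (blockNo s t) (v i)

-- The blocks of the paper.  T̃_0 = T_0 ∪ … ∪ T_(q-1) is indexed by Fin q × Fin r.
module Blocks {n f r : ℕ} {R : Set} (M : Fin n → Fin n → R) (φ : Fin n → Fin n)
              (TF : Fin f → Fin n) (v : Fin r → Fin n) (q : ℕ) where
  Fblk : Fin f → Fin f → R
  Fblk a b = M (TF a) (TF b)
  Hblk : Fin f → Fin q × Fin r → R
  Hblk a (t , i) = M (TF a) (pow φ (toℕ t) (v i))
  Lblk : Fin q × Fin r → Fin f → R
  Lblk (t , i) b = M (pow φ (toℕ t) (v i)) (TF b)
  Cblk : ℕ → Fin r → Fin r → R
  Cblk m i j = M (v i) (pow φ m (v j))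
  Dblk : ℕ → Fin q × Fin r → Fin q × Fin r → R
  Dblk s (t , i) (t' , j) = M (pow φ (toℕ t) (v i)) (pow φ (s * q + toℕ t') (v j))

-- Since φ^(p^N) = id, every orbit length divides p^N; an orbit in T_F has a proper divisor
-- as length, so it divides p^(N-1) and φ^(p^(N-1)) fixes T_F pointwise.  Compatibility
-- makes M invariant under applying any power of φ to both indices.  Applying φ^(s p^(N-1))
-- gives the repeated H and L blocks, applying φ^(p^N - m) (which takes T_m to T_0) gives
-- the r×r circulant structure, and φ^((p - s) p^(N-1)) (which takes T̃_s to T̃_0) the coarser
-- one.  The reordering is a bijection because φ^m(v_i), 0 ≤ m < p^N, are pairwise distinct
-- and every vertex lies in T_F or in an orbit of full length.
module Submission where

open import Defs
open import Data.Nat using (ℕ; _^_; _∸_; _<_)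
open import Data.Nat.Primality using (Prime)
open import Data.Fin using (Fin; toℕ)
open import Data.Product using (_×_; _,_)
open import Data.Sum using (inj₁; inj₂)
open import Function.Definitions using (Bijective)
open import Relation.Binary.PropositionalEquality using (_≡_)

open import Data.Nat
open import Data.Nat.Properties
open import Data.Nat.DivMod
open import Data.Nat.Divisibility
open import Data.Nat.Coprimality using (Coprime; coprime-divisor)
open import Data.Nat.Induction using (<-rec)
open import Data.Nat.Primality using (prime⇒irreducible; prime⇒nonZero; prime⇒nonTrivial)
open import Data.Nat.Tactic.RingSolver using (solve-∀)
open import Data.Fin using (fromℕ<; combine; remQuot)
import Data.Fin.Properties as Fin
open import Data.Product using (∃; proj₁; proj₂)
open import Function.Definitions using (Injective; Surjective)
open import Relation.Binary.Definitions using (tri<; tri≈; tri>)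
open import Relation.Binary.PropositionalEquality
open import Relation.Nullary using (¬_; Dec; yes; no; contradiction)
open import Relation.Nullary.Decidable using (_×-dec_)

∣p^[1+k]∧≢⇒∣p^k : ∀ {p} → Prime p → ∀ k {l} → l ∣ p ^ suc k → l ≢ p ^ suc k → l ∣ p ^ k
∣p^[1+k]∧≢⇒∣p^k {p} pr k {l} l∣p^[1+k] l≢p^[1+k] with p ∣? l
... | no p∤l = coprime-divisor l⊥p l∣p^[1+k]
  where
  l⊥p : Coprime l p
  l⊥p (d∣l , d∣p) with prime⇒irreducible pr d∣p
  ... | inj₁ d≡1 = d≡1
  ... | inj₂ refl = contradiction d∣l p∤l
... | yes (divides c refl) = cp∣p^j k l∣p^[1+k] l≢p^[1+k]
  where
  instance _ = prime⇒nonZero pr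
  c∣p^j : ∀ j → c * p ∣ p ^ suc j → c ∣ p ^ j
  c∣p^j j cp∣ = *-cancelʳ-∣ p (subst (c * p ∣_) (*-comm p (p ^ j)) cp∣)
  cp∣p^j : ∀ j → c * p ∣ p ^ suc j → c * p ≢ p ^ suc j → c * p ∣ p ^ j
  cp∣p^j zero    cp∣p cp≢p =
    contradiction (trans (cong (_* p) (∣1⇒≡1 (c∣p^j 0 cp∣p))) (*-comm 1 p)) cp≢p
  cp∣p^j (suc j) cp∣ cp≢ = subst (c * p ∣_) (*-comm (p ^ j) p) (*-monoˡ-∣ p c∣p^j′)
    where
    c∣p^j′ : c ∣ p ^ j
    c∣p^j′ = ∣p^[1+k]∧≢⇒∣p^k pr j (c∣p^j (suc j) cp∣)
               (λ c≡p^[1+j] → cp≢ (trans (cong (_* p) c≡p^[1+j]) (*-comm (p ^ suc j) p)))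

s<p∧t<q⇒s*q+t<p*q : ∀ {s p t q} → s < p → t < q → s * q + t < p * q
s<p∧t<q⇒s*q+t<p*q {s} {p} {t} {q} s<p t<q = begin-strict
  s * q + t  <⟨ +-monoʳ-< (s * q) t<q ⟩
  s * q + q  ≡⟨ +-comm (s * q) q ⟩
  suc s * q  ≤⟨ *-monoˡ-≤ q s<p ⟩
  p * q      ∎
  where open ≤-Reasoning

[m*q+t]%[p*q]≡[m%p]*q+t : ∀ m p q {t} .{{_ : NonZero p}} .{{_ : NonZero (p * q)}} →
                          t < q → (m * q + t) % (p * q) ≡ m % p * q + t
[m*q+t]%[p*q]≡[m%p]*q+t m p q {t} t<q = begin
  (m * q + t) % (p * q)                        ≡⟨ cong (λ x → (x * q + t) % (p * q)) (m≡m%n+[m/n]*n m p) ⟩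
  ((m % p + m / p * p) * q + t) % (p * q)      ≡⟨ cong (_% (p * q)) (regroup (m % p) (m / p) p q t) ⟩
  (m % p * q + t + m / p * (p * q)) % (p * q)  ≡⟨ [m+kn]%n≡m%n (m % p * q + t) (m / p) (p * q) ⟩
  (m % p * q + t) % (p * q)                    ≡⟨ m<n⇒m%n≡m (s<p∧t<q⇒s*q+t<p*q (m%n<n m p) t<q) ⟩
  m % p * q + t                                ∎
  where
  open ≡-Reasoning
  regroup : ∀ r d p q t → (r + d * p) * q + t ≡ r * q + t + d * (p * q)
  regroup = solve-∀

subMod≡[∸+]% : ∀ k b a .{{_ : NonZero k}} → a ≤ k → subMod k b a ≡ (k ∸ a + b) % k
subMod≡[∸+]% (suc k) b a a≤k = cong (_% suc k) (trans (+-∸-assoc b a≤k) (+-comm b (suc k ∸ a)))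

least-witness : ∀ {P : ℕ → Set} → (∀ j → Dec (P j)) → ∀ k → P k →
                ∃ λ l → l ≤ k × P l × (∀ j → j < l → ¬ P j)
least-witness {P} P? = <-rec _ search
  where
  search : ∀ k → (∀ {j} → j < k → P j → ∃ λ l → l ≤ j × P l × (∀ i → i < l → ¬ P i)) →
           P k → ∃ λ l → l ≤ k × P l × (∀ j → j < l → ¬ P j)
  search k below Pk with anyUpTo? P? k
  ... | yes (j , j<k , Pj) = let l , l≤j , Pl , least = below j<k Pj
                             in l , ≤-trans l≤j (<⇒≤ j<k) , Pl , least
  ... | no none = k , ≤-refl , Pk , λ j j<k Pj → none (j , j<k , Pj)

module Iterates {n} (φ : Fin n → Fin n) where

  pow-+ : ∀ a b x → pow φ (a + b) x ≡ pow φ a (pow φ b x)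
  pow-+ zero    b x = refl
  pow-+ (suc a) b x = cong φ (pow-+ a b x)

  pow-*-fixed : ∀ {l w} → pow φ l w ≡ w → ∀ c → pow φ (c * l) w ≡ w
  pow-*-fixed         fixed zero    = refl
  pow-*-fixed {l} {w} fixed (suc c) = begin
    pow φ (l + c * l) w      ≡⟨ pow-+ l (c * l) w ⟩
    pow φ l (pow φ (c * l) w) ≡⟨ cong (pow φ l) (pow-*-fixed fixed c) ⟩
    pow φ l w                ≡⟨ fixed ⟩
    w                        ∎
    where open ≡-Reasoning

  pow-∣-fixed : ∀ {l k w} → pow φ l w ≡ w → l ∣ k → pow φ k w ≡ w
  pow-∣-fixed fixed (divides c refl) = pow-*-fixed fixed c

  pow-% : ∀ {l w} .{{_ : NonZero l}} → pow φ l w ≡ w → ∀ k → pow φ (k % l) w ≡ pow φ k w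
  pow-% {l} {w} fixed k = sym (begin
    pow φ k w                            ≡⟨ cong (λ j → pow φ j w) (m≡m%n+[m/n]*n k l) ⟩
    pow φ (k % l + k / l * l) w          ≡⟨ pow-+ (k % l) (k / l * l) w ⟩
    pow φ (k % l) (pow φ (k / l * l) w)  ≡⟨ cong (pow φ (k % l)) (pow-*-fixed fixed (k / l)) ⟩
    pow φ (k % l) w                      ∎)
    where open ≡-Reasoning

  orbitSize-∣ : ∀ {w l k} → OrbitSize φ w l → pow φ k w ≡ w → l ∣ k
  orbitSize-∣ {w} {l} {k} (0<l , fixed , least) k-fixed =
    m%n≡0⇒n∣m k l (remainder-zero (k % l) refl)
    where
    instance _ = >-nonZero 0<l
    remainder-zero : ∀ x → k % l ≡ x → k % l ≡ 0
    remainder-zero zero    k%l≡0 = k%l≡0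
    remainder-zero (suc x) k%l≡1+x = contradiction (trans (pow-% fixed k) k-fixed)
      (subst (λ j → pow φ j w ≢ w) (sym k%l≡1+x)
             (least (suc x) z<s (subst (_< l) k%l≡1+x (m%n<n k l))))

  orbitSize-exists : ∀ {K} w → 0 < K → pow φ K w ≡ w → ∃ λ l → OrbitSize φ w l × l ≤ K
  orbitSize-exists {K} w 0<K K-fixed
    with least-witness (λ j → (0 <? j) ×-dec (pow φ j w Fin.≟ w)) K (0<K , K-fixed)
  ... | l , l≤K , (0<l , l-fixed) , least =
    l , (0<l , l-fixed , λ j 0<j j<l j-fixed → least j j<l (0<j , j-fixed)) , l≤K

  module Invariant {R : Set} (M : Fin n → Fin n → R) (M-invariant : ∀ i j → M (φ i) (φ j) ≡ M i j) where

    pow-invariant : ∀ k i j → M (pow φ k i) (pow φ k j) ≡ M i j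
    pow-invariant zero    i j = refl
    pow-invariant (suc k) i j = trans (M-invariant _ _) (pow-invariant k i j)

    pow-fixed-invariantˡ : ∀ k {x} → pow φ k x ≡ x → ∀ y → M x (pow φ k y) ≡ M x y
    pow-fixed-invariantˡ k {x} fixed y =
      trans (cong (λ z → M z (pow φ k y)) (sym fixed)) (pow-invariant k x y)

    pow-fixed-invariantʳ : ∀ k {y} → pow φ k y ≡ y → ∀ x → M (pow φ k x) y ≡ M x y
    pow-fixed-invariantʳ k {y} fixed x =
      trans (cong (M (pow φ k x)) (sym fixed)) (pow-invariant k x y)

  module _ (φ-injective : Injective _≡_ _≡_ φ) where

    pow-injective : ∀ a {x y} → pow φ a x ≡ pow φ a y → x ≡ y
    pow-injective zero    eq = eq
    pow-injective (suc a) eq = pow-injective a (φ-injective eq)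

    pow-fixes-image⇒pow-fixes : ∀ k m x → pow φ k (pow φ m x) ≡ pow φ m x → pow φ k x ≡ x
    pow-fixes-image⇒pow-fixes k m x fixed = pow-injective m (begin
      pow φ m (pow φ k x)  ≡⟨ pow-+ m k x ⟨
      pow φ (m + k) x      ≡⟨ cong (λ j → pow φ j x) (+-comm m k) ⟩
      pow φ (k + m) x      ≡⟨ pow-+ k m x ⟩
      pow φ k (pow φ m x)  ≡⟨ fixed ⟩
      pow φ m x            ∎)
      where open ≡-Reasoning

    orbitSize⇒pow-distinct : ∀ {w l m m'} → OrbitSize φ w l → m < m' → m' < l →
                             pow φ m w ≢ pow φ m' w
    orbitSize⇒pow-distinct {w} {l} {m} {m'} (_ , _ , least) m<m' m'<l eq =
      least (m' ∸ m) (m<n⇒0<n∸m m<m') (≤-<-trans (m∸n≤m m' m) m'<l)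
        (pow-fixes-image⇒pow-fixes (m' ∸ m) m w (begin
          pow φ (m' ∸ m) (pow φ m w)  ≡⟨ pow-+ (m' ∸ m) m w ⟨
          pow φ (m' ∸ m + m) w        ≡⟨ cong (λ j → pow φ j w) (m∸n+n≡m (<⇒≤ m<m')) ⟩
          pow φ m' w                  ≡⟨ eq ⟨
          pow φ m w                   ∎))
      where open ≡-Reasoning

    orbitSize-pow-injective : ∀ {w l m m'} → OrbitSize φ w l → m < l → m' < l →
                              pow φ m w ≡ pow φ m' w → m ≡ m'
    orbitSize-pow-injective {m = m} {m'} size m<l m'<l eq with <-cmp m m'
    ... | tri< m<m' _ _ = contradiction eq (orbitSize⇒pow-distinct size m<m' m'<l)
    ... | tri≈ _ m≡m' _ = m≡m'
    ... | tri> _ _ m'<m = contradiction (sym eq) (orbitSize⇒pow-distinct size m'<m m<l)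

module BlockStructure {n r f : ℕ} {R : Set} (M : Fin n → Fin n → R) {p : ℕ} (p-prime : Prime p) (N' : ℕ)
  (φ : Fin n → Fin n) (φ-injective : Injective _≡_ _≡_ φ)
  (M-invariant : ∀ i j → M (φ i) (φ j) ≡ M i j)
  (period : ∀ x → pow φ (p ^ suc N') x ≡ x)
  (v : Fin r → Fin n) (transversal : IsTransversal φ (p ^ suc N') v)
  (TF : Fin f → Fin n) (enumerates : Enumerates-T_F φ (p ^ suc N') TF) where

  open Iterates φ
  open Invariant M M-invariant

  q K : ℕ
  q = p ^ N'
  K = p * q

  instance
    p≢0 : NonZero p
    p≢0 = prime⇒nonZero p-prime
    q≢0 : NonZero q
    q≢0 = m^n≢0 p N'
    K≢0 : NonZero K
    K≢0 = m*n≢0 p q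

  σ : Index f p q r → Fin n
  σ = order {p = p} {q = q} φ TF v

  blockNo<K : ∀ (s : Fin p) (t : Fin q) → blockNo s t < K
  blockNo<K s t = s<p∧t<q⇒s*q+t<p*q (Fin.toℕ<n s) (Fin.toℕ<n t)

  blockNo≡toℕ-combine : ∀ (s : Fin p) (t : Fin q) → blockNo s t ≡ toℕ (combine s t)
  blockNo≡toℕ-combine s t = trans (cong (_+ toℕ t) (*-comm (toℕ s) q)) (sym (Fin.toℕ-combine s t))

  blockNo-injective : ∀ (s s' : Fin p) (t t' : Fin q) →
                      blockNo s t ≡ blockNo s' t' → s ≡ s' × t ≡ t'
  blockNo-injective s s' t t' eq =
    Fin.combine-injectiveˡ s t s' t' combine-eq , Fin.combine-injectiveʳ s t s' t' combine-eq
    where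
    combine-eq : combine s t ≡ combine s' t'
    combine-eq = Fin.toℕ-injective
      (trans (sym (blockNo≡toℕ-combine s t)) (trans eq (blockNo≡toℕ-combine s' t')))

  blockNo-surjective : ∀ {m} → m < K → ∃ λ ((s , t) : Fin p × Fin q) → blockNo s t ≡ m
  blockNo-surjective {m} m<K = remQuot {p} q k , (begin
    blockNo s t            ≡⟨ blockNo≡toℕ-combine s t ⟩
    toℕ (combine s t)      ≡⟨ cong toℕ (Fin.combine-remQuot {p} q k) ⟩
    toℕ k                  ≡⟨ Fin.toℕ-fromℕ< m<K ⟩
    m                      ∎)
    where
    open ≡-Reasoning
    k = fromℕ< m<K
    s = proj₁ (remQuot {p} q k)
    t = proj₂ (remQuot {p} q k)

  q<K : q < K
  q<K = subst (q <_) (*-comm q p) (m<m*n q p (nonTrivial⇒n>1 p {{prime⇒nonTrivial p-prime}}))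

  TF-fixed : ∀ a → pow φ q (TF a) ≡ TF a
  TF-fixed a with proj₁ (proj₂ enumerates) (TF a) (a , refl)
  ... | l , size , l<K = pow-∣-fixed (proj₁ (proj₂ size))
    (∣p^[1+k]∧≢⇒∣p^k p-prime N' (orbitSize-∣ size (period (TF a))) (<⇒≢ l<K))

  rewind : ∀ m x → m ≤ K → pow φ (K ∸ m) (pow φ m x) ≡ x
  rewind m x m≤K = begin
    pow φ (K ∸ m) (pow φ m x)  ≡⟨ pow-+ (K ∸ m) m x ⟨
    pow φ (K ∸ m + m) x        ≡⟨ cong (λ j → pow φ j x) (m∸n+n≡m m≤K) ⟩
    pow φ K x                  ≡⟨ period x ⟩
    x                          ∎
    where open ≡-Reasoning

  rotate : ∀ d {m m' a b} x y → (d + m) % K ≡ a → (d + m') % K ≡ b →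
           M (pow φ m x) (pow φ m' y) ≡ M (pow φ a x) (pow φ b y)
  rotate d {m} {m'} x y refl refl = begin
    M (pow φ m x) (pow φ m' y)
      ≡⟨ pow-invariant d _ _ ⟨
    M (pow φ d (pow φ m x)) (pow φ d (pow φ m' y))
      ≡⟨ cong₂ M (pow-+ d m x) (pow-+ d m' y) ⟨
    M (pow φ (d + m) x) (pow φ (d + m') y)
      ≡⟨ cong₂ M (pow-% (period x) (d + m)) (pow-% (period y) (d + m')) ⟨
    M (pow φ ((d + m) % K) x) (pow φ ((d + m') % K) y)
      ∎
    where open ≡-Reasoning

  digits-shift : ∀ e s {t} → t < q → (e * q + (s * q + t)) % K ≡ (e + s) % p * q + t
  digits-shift e s {t} t<q =
    trans (cong (_% K) (regroup e s q t)) ([m*q+t]%[p*q]≡[m%p]*q+t (e + s) p q t<q)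
    where
    regroup : ∀ e s q t → e * q + (s * q + t) ≡ (e + s) * q + t
    regroup = solve-∀

  H-block : ∀ a (s : Fin p) (t : Fin q) i →
            M (TF a) (pow φ (blockNo s t) (v i)) ≡ M (TF a) (pow φ (toℕ t) (v i))
  H-block a s t i = trans (cong (M (TF a)) (pow-+ (toℕ s * q) (toℕ t) (v i)))
                          (pow-fixed-invariantˡ (toℕ s * q) (pow-*-fixed (TF-fixed a) (toℕ s)) _)

  L-block : ∀ (s : Fin p) (t : Fin q) i b →
            M (pow φ (blockNo s t) (v i)) (TF b) ≡ M (pow φ (toℕ t) (v i)) (TF b)
  L-block s t i b = trans (cong (λ x → M x (TF b)) (pow-+ (toℕ s * q) (toℕ t) (v i)))
                          (pow-fixed-invariantʳ (toℕ s * q) (pow-*-fixed (TF-fixed b) (toℕ s)) _)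

  C-block : ∀ (s : Fin p) (t : Fin q) i (s' : Fin p) (t' : Fin q) j →
            M (pow φ (blockNo s t) (v i)) (pow φ (blockNo s' t') (v j))
            ≡ M (v i) (pow φ (subMod K (blockNo s' t') (blockNo s t)) (v j))
  C-block s t i s' t' j = rotate (K ∸ m) (v i) (v j)
    (trans (cong (_% K) (m∸n+n≡m m≤K)) (n%n≡0 K))
    (sym (subMod≡[∸+]% K (blockNo s' t') m m≤K))
    where
    m = blockNo s t
    m≤K = <⇒≤ (blockNo<K s t)

  D-block : ∀ (s : Fin p) (t : Fin q) i (s' : Fin p) (t' : Fin q) j →
            M (pow φ (blockNo s t) (v i)) (pow φ (blockNo s' t') (v j))
            ≡ M (pow φ (toℕ t) (v i)) (pow φ (subMod p (toℕ s') (toℕ s) * q + toℕ t') (v j))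
  D-block s t i s' t' j = rotate ((p ∸ toℕ s) * q) (v i) (v j)
    (trans (digits-shift (p ∸ toℕ s) (toℕ s) (Fin.toℕ<n t))
           (cong (λ x → x * q + toℕ t) (trans (cong (_% p) (m∸n+n≡m s≤p)) (n%n≡0 p))))
    (trans (digits-shift (p ∸ toℕ s) (toℕ s') (Fin.toℕ<n t'))
           (cong (λ x → x * q + toℕ t') (sym (subMod≡[∸+]% p (toℕ s') (toℕ s) s≤p))))
    where
    s≤p = <⇒≤ (Fin.toℕ<n s)

  TF≢orbit : ∀ a m i → TF a ≢ pow φ m (v i)
  TF≢orbit a m i eq =
    proj₂ (proj₂ (proj₁ transversal i)) q (>-nonZero⁻¹ q) q<K
      (pow-fixes-image⇒pow-fixes φ-injective q m (v i) (subst (λ x → pow φ q x ≡ x) eq (TF-fixed a)))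

  transversal-index-unique : ∀ m m' i i' → m' ≤ K → pow φ m (v i) ≡ pow φ m' (v i') → i ≡ i'
  transversal-index-unique m m' i i' m'≤K eq =
    proj₁ (proj₂ transversal) i i' (K ∸ m' + m) (begin
      pow φ (K ∸ m' + m) (v i)          ≡⟨ pow-+ (K ∸ m') m (v i) ⟩
      pow φ (K ∸ m') (pow φ m (v i))    ≡⟨ cong (pow φ (K ∸ m')) eq ⟩
      pow φ (K ∸ m') (pow φ m' (v i'))  ≡⟨ rewind m' (v i') m'≤K ⟩
      v i'                              ∎)
    where open ≡-Reasoning

  σ-injective : Injective _≡_ _≡_ σ
  σ-injective {inj₁ a} {inj₁ b} eq = cong inj₁ (proj₁ enumerates eq)
  σ-injective {inj₁ a} {inj₂ (s , t , i)} eq = contradiction eq (TF≢orbit a (blockNo s t) i)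
  σ-injective {inj₂ (s , t , i)} {inj₁ a} eq = contradiction (sym eq) (TF≢orbit a (blockNo s t) i)
  σ-injective {inj₂ (s , t , i)} {inj₂ (s' , t' , i')} eq
    with refl ← transversal-index-unique (blockNo s t) (blockNo s' t') i i' (<⇒≤ (blockNo<K s' t')) eq
    with refl , refl ← blockNo-injective s s' t t'
           (orbitSize-pow-injective φ-injective (proj₁ transversal i) (blockNo<K s t) (blockNo<K s' t') eq)
    = refl

  σ-surjective : Surjective _≡_ _≡_ σ
  σ-surjective w with orbitSize-exists w (>-nonZero⁻¹ K) (period w)
  ... | l , size , l≤K with l <? K
  ...   | yes l<K = let a , TFa≡w = proj₂ (proj₂ enumerates) w (l , size , l<K)
                    in inj₁ a , λ { refl → TFa≡w }
  ...   | no l≮K  = let i , j , v-reaches-w = proj₂ (proj₂ transversal) w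
                                                (subst (OrbitSize φ w) (≤-antisym l≤K (≮⇒≥ l≮K)) size)
                        (s , t) , blockNo≡j%K = blockNo-surjective (m%n<n j K)
                    in inj₂ (s , t , i) , λ { refl → begin
                         pow φ (blockNo s t) (v i)  ≡⟨ cong (λ m → pow φ m (v i)) blockNo≡j%K ⟩
                         pow φ (j % K) (v i)        ≡⟨ pow-% (period (v i)) j ⟩
                         pow φ j (v i)              ≡⟨ v-reaches-w ⟩
                         w                          ∎ }
    where open ≡-Reasoning

proposition3p2 :
  (n : ℕ) (W : Set) (G : Fin n → Fin n → W) (R : Set) (M : Fin n → Fin n → R)
  (p N : ℕ) → Prime p → 0 < N →
  (φ : Fin n → Fin n) → IsAutomorphism G φ → HasOrder φ (p ^ N) →
  AutCompatible G M →
  (r : ℕ) (v : Fin r → Fin n) → IsTransversal φ (p ^ N) v →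
  (f : ℕ) (TF : Fin f → Fin n) → Enumerates-T_F φ (p ^ N) TF →
  let q = p ^ (N ∸ 1)
      σ = order {p = p} {q = q} φ TF v
      P = λ x y → M (σ x) (σ y)
      open Blocks M φ TF v q
  in Bijective _≡_ _≡_ σ
   × (∀ a b → P (inj₁ a) (inj₁ b) ≡ Fblk a b)
   × (∀ a s t i → P (inj₁ a) (inj₂ (s , t , i)) ≡ Hblk a (t , i))
   × (∀ s t i b → P (inj₂ (s , t , i)) (inj₁ b) ≡ Lblk (t , i) b)
   × (∀ s t i s' t' j → P (inj₂ (s , t , i)) (inj₂ (s' , t' , j))
        ≡ Cblk (subMod (p ^ N) (blockNo {p} {q} s' t') (blockNo {p} {q} s t)) i j)
   × (∀ s t i s' t' j → P (inj₂ (s , t , i)) (inj₂ (s' , t' , j))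
        ≡ Dblk (subMod p (toℕ s') (toℕ s)) (t , i) (t' , j))
proposition3p2 n W G R M p zero    p-prime () φ automorphism φ-order compatible r v transversal f TF enumerates
proposition3p2 n W G R M p (suc N') p-prime _ φ automorphism φ-order compatible r v transversal f TF enumerates =
  (σ-injective , σ-surjective) , (λ a b → refl) , H-block , L-block , C-block , D-block
  where
  open BlockStructure M p-prime N' φ (proj₁ (proj₁ automorphism)) (compatible φ automorphism)
               (proj₁ (proj₂ φ-order)) v transversal TF enumerates
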